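{- Let $f:\mathbb{N}\to\mathbb{N}$ represent an infinite binary tree, and for each $k\in\mathbb{N}$ let $\sigma_k$ be the leftmost (lexicographically least) finite branch of length $k$ in $f$, and let $x_k:=\sigma_k*0^{\infty}\in\{0,1\}^{\mathbb{N}}$ (the sequence $\sigma_k$ continued by zeros). Let $S$ be the set of infinite paths through $f$. Then $(x_k)$ is Fejér monotone with respect to $S$ in the Baire space metric $d$, i.e. $d(x_{k+1},b)\le d(x_k,b)$ for all $b\in S$ and all $k\in\mathbb{N}$.
   Context: Finite 0/1-sequences are coded by natural numbers via a fixed primitive recursive coding, $\overline{b}x$ denoting the code of $(b(0),\dots,b(x-1))$, $n*m$ concatenation and $\langle x\rangle$ a one-element sequence. $f$ represents a binary tree if $\forall n,m\,(f(n*m)=0\to f(n)=0)$ and $\forall n,x\,(f(n*\langle x\rangle)=0\to x\le 1)$; it is infinite if for every $x$ there is a sequence of length $x$ whose code $n$ satisfies $f(n)=0$. A finite branch of length $k$ in $f$ is a sequence $\sigma\in\{0,1\}^k$ with $f(\sigma)=0$. An infinite path through $f$ is $b:\mathbb{N}\to\{0,1\}$ with $f(\overline{b}x)=0$ for all $x$. The Baire space metric is $d(u,v)=2^{ -\min\{k:u(k)\neq v(k)\}-1}$ if $u\neq v$ and $d(u,v)=0$ otherwise. -}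

module Defs where

open import Data.Nat using (ℕ; zero; suc; _≤_; _<_)
open import Data.List using (List; []; _∷_; _++_; [_]; length; map; upTo)
open import Data.Product using (Σ; ∃; _×_; _,_)
open import Data.Sum using (_⊎_)
open import Data.Rational using (ℚ; 0ℚ; 1ℚ; ½; _*_)
open import Relation.Binary.PropositionalEquality using (_≡_; _≢_)

-- Finite sequences of naturals are represented directly as lists
-- (standing in for their codes under a fixed primitive recursive coding);
-- n * m is list concatenation, ⟨x⟩ is [ x ].

IsBinaryTree : (List ℕ → ℕ) → Set
IsBinaryTree f =
  (∀ (n m : List ℕ) → f (n ++ m) ≡ 0 → f n ≡ 0) ×
  (∀ (n : List ℕ) (x : ℕ) → f (n ++ [ x ]) ≡ 0 → x ≤ 1)

IsInfinite : (List ℕ → ℕ) → Set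
IsInfinite f = ∀ (x : ℕ) → ∃ λ (n : List ℕ) → length n ≡ x × f n ≡ 0

data Binary : List ℕ → Set where
  []  : Binary []
  _∷_ : ∀ {x s} → x ≤ 1 → Binary s → Binary (x ∷ s)

IsBranch : (List ℕ → ℕ) → ℕ → List ℕ → Set
IsBranch f k σ = length σ ≡ k × Binary σ × f σ ≡ 0

data _≤lex_ : List ℕ → List ℕ → Set where
  []≤   : ∀ {t} → [] ≤lex t
  here  : ∀ {x y s t} → x < y → (x ∷ s) ≤lex (y ∷ t)
  there : ∀ {x s t} → s ≤lex t → (x ∷ s) ≤lex (x ∷ t)

IsLeftmostBranch : (List ℕ → ℕ) → ℕ → List ℕ → Set
IsLeftmostBranch f k σ = IsBranch f k σ × (∀ τ → IsBranch f k τ → σ ≤lex τ)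

extendZeros : List ℕ → ℕ → ℕ
extendZeros []      n       = 0
extendZeros (x ∷ s) zero    = x
extendZeros (x ∷ s) (suc n) = extendZeros s n

initSeg : (ℕ → ℕ) → ℕ → List ℕ
initSeg b x = map b (upTo x)

IsPath : (List ℕ → ℕ) → (ℕ → ℕ) → Set
IsPath f b = (∀ n → b n ≤ 1) × (∀ x → f (initSeg b x) ≡ 0)

half^ : ℕ → ℚ
half^ zero    = 1ℚ
half^ (suc n) = ½ * half^ n

BaireDist : (ℕ → ℕ) → (ℕ → ℕ) → ℚ → Set
BaireDist u v r =
  ((∀ n → u n ≡ v n) × r ≡ 0ℚ) ⊎
  (∃ λ k → (∀ i → i < k → u i ≡ v i) × u k ≢ v k × r ≡ half^ (suc k))

{-# OPTIONS --safe #-}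
-- Dropping the last entry of σₖ₊₁ leaves a branch of length k, which σₖ lexicographically
-- precedes; so σₖ0 ≤lex σₖ₊₁ ≤lex b̄(k+1).  A lexicographic sandwich between lists of equal
-- length shares every prefix common to its two bounds, hence xₖ₊₁ agrees with b on every
-- initial segment where xₖ does, and its distance to b is no larger.
module Submission where

open import Defs
open import Data.Nat using (ℕ; suc)
open import Data.List using (List)
open import Data.Rational using (ℚ; _≤_)

open import Data.Empty using (⊥-elim)
open import Data.List using ([]; _∷_; _++_; [_]; _∷ʳ_; length; map; applyUpTo; upTo; _∷ʳ′_; initLast)
open import Data.List.Properties using (length-++; length-map; length-upTo; map-upTo)
open import Data.Nat as ℕ using (zero; z≤n; s≤s; z<s; _<_; _<?_)
open import Data.Nat.Properties as ℕ using (suc-injective; +-comm; <-irrefl; <-asym; ≮⇒≥; <⇒≤)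
open import Data.Product using (_×_; _,_)
open import Data.Rational as ℚ using (0ℚ; 1ℚ; ½; _*_)
open import Data.Rational.Properties as ℚ using (*-monoˡ-≤-nonNeg; *-monoʳ-≤-nonNeg; *-zeroʳ; *-identityˡ)
open import Data.Sum using (inj₁; inj₂)
open import Data.Unit using (tt)
open import Relation.Binary.PropositionalEquality using (_≡_; refl; sym; trans; cong; subst; _≗_; module ≡-Reasoning)
open import Relation.Nullary using (yes; no)
open import Relation.Nullary.Decidable using (toWitness)

half^-nonNeg : ∀ n → 0ℚ ≤ half^ n
half^-nonNeg zero    = toWitness {a? = 0ℚ ℚ.≤? 1ℚ} tt
half^-nonNeg (suc n) = begin
  0ℚ          ≡⟨ sym (*-zeroʳ ½) ⟩
  ½ * 0ℚ      ≤⟨ *-monoˡ-≤-nonNeg ½ (half^-nonNeg n) ⟩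
  ½ * half^ n ∎
  where open ℚ.≤-Reasoning

half^-suc-≤ : ∀ n → half^ (suc n) ≤ half^ n
half^-suc-≤ n = begin
  ½ * half^ n  ≤⟨ *-monoʳ-≤-nonNeg (half^ n) {{ℚ.nonNegative (half^-nonNeg n)}} (toWitness {a? = ½ ℚ.≤? 1ℚ} tt) ⟩
  1ℚ * half^ n ≡⟨ *-identityˡ (half^ n) ⟩
  half^ n      ∎
  where open ℚ.≤-Reasoning

half^-antitone : ∀ {m n} → m ℕ.≤ n → half^ n ≤ half^ m
half^-antitone {zero}  {zero}  _       = ℚ.≤-refl
half^-antitone {zero}  {suc n} _       = ℚ.≤-trans (half^-suc-≤ n) (half^-antitone {zero} {n} z≤n)
half^-antitone {suc m} {suc n} (s≤s p) = *-monoˡ-≤-nonNeg ½ (half^-antitone p)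

AgreeBelow : ℕ → (ℕ → ℕ) → (ℕ → ℕ) → Set
AgreeBelow i u v = ∀ m → m < i → u m ≡ v m

BaireDist-nonNeg : ∀ {u v r} → BaireDist u v r → 0ℚ ≤ r
BaireDist-nonNeg (inj₁ (_ , refl))         = ℚ.≤-refl
BaireDist-nonNeg (inj₂ (k , _ , _ , refl)) = half^-nonNeg (suc k)

BaireDist-≤ : ∀ {u v w r s} → (∀ i → AgreeBelow i u w → AgreeBelow i v w) →
  BaireDist v w r → BaireDist u w s → r ≤ s
BaireDist-≤ agree (inj₁ (_ , refl)) ds = BaireDist-nonNeg ds
BaireDist-≤ agree (inj₂ (k , _ , v≢w , _)) (inj₁ (u≗w , _)) =
  ⊥-elim (v≢w (agree (suc k) (λ m _ → u≗w m) k ℕ.≤-refl))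
BaireDist-≤ agree (inj₂ (k , _ , v≢w , refl)) (inj₂ (l , u≐w , _ , refl)) with k <? l
... | yes k<l = ⊥-elim (v≢w (agree l u≐w k k<l))
... | no  k≮l = half^-antitone (s≤s (≮⇒≥ k≮l))

extendZeros-∷ʳ0 : ∀ s → extendZeros (s ∷ʳ 0) ≗ extendZeros s
extendZeros-∷ʳ0 []      zero    = refl
extendZeros-∷ʳ0 []      (suc m) = refl
extendZeros-∷ʳ0 (x ∷ s) zero    = refl
extendZeros-∷ʳ0 (x ∷ s) (suc m) = extendZeros-∷ʳ0 s m

extendZeros-≥length : ∀ s {m} → length s ℕ.≤ m → extendZeros s m ≡ 0
extendZeros-≥length []      _       = refl
extendZeros-≥length (x ∷ s) (s≤s p) = extendZeros-≥length s p

extendZeros-applyUpTo : ∀ f {n m} → m < n → extendZeros (applyUpTo f n) m ≡ f m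
extendZeros-applyUpTo f {suc n} {zero}  _       = refl
extendZeros-applyUpTo f {suc n} {suc m} (s≤s p) = extendZeros-applyUpTo (λ i → f (suc i)) p

extendZeros-initSeg : ∀ b {k m} → m < k → extendZeros (initSeg b k) m ≡ b m
extendZeros-initSeg b {k} {m} m<k =
  trans (cong (λ s → extendZeros s m) (map-upTo b k)) (extendZeros-applyUpTo b m<k)

length-∷ʳ : ∀ (s : List ℕ) x → length (s ∷ʳ x) ≡ suc (length s)
length-∷ʳ s x = trans (length-++ s) (+-comm (length s) 1)

Binary-map : ∀ {g : ℕ → ℕ} → (∀ n → g n ℕ.≤ 1) → ∀ s → Binary (map g s)
Binary-map g≤1 []      = []
Binary-map g≤1 (x ∷ s) = g≤1 x ∷ Binary-map g≤1 s

Binary-++⁻ˡ : ∀ s {t} → Binary (s ++ t) → Binary s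
Binary-++⁻ˡ []      _       = []
Binary-++⁻ˡ (x ∷ s) (p ∷ q) = p ∷ Binary-++⁻ˡ s q

≤lex-∷ʳ : ∀ {s t x y} → s ≤lex t → length s ≡ length t → x ℕ.≤ y → (s ∷ʳ x) ≤lex (t ∷ʳ y)
≤lex-∷ʳ {t = []} []≤ _ x≤y with ℕ.m≤n⇒m<n∨m≡n x≤y
... | inj₁ x<y  = here x<y
... | inj₂ refl = there []≤
≤lex-∷ʳ {t = _ ∷ _} []≤ ()
≤lex-∷ʳ (here x<y) _  _   = here x<y
≤lex-∷ʳ (there p)  eq x≤y = there (≤lex-∷ʳ p (suc-injective eq) x≤y)

≤lex-∷-sandwich : ∀ {x y z s t u} → (x ∷ s) ≤lex (y ∷ t) → (y ∷ t) ≤lex (z ∷ u) → x ≡ z →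
  y ≡ z × s ≤lex t × t ≤lex u
≤lex-∷-sandwich (here x<y) (here y<x) refl = ⊥-elim (<-asym x<y y<x)
≤lex-∷-sandwich (here x<x) (there _)  refl = ⊥-elim (<-irrefl refl x<x)
≤lex-∷-sandwich (there _)  (here x<x) refl = ⊥-elim (<-irrefl refl x<x)
≤lex-∷-sandwich (there p)  (there q)  refl = refl , p , q

≤lex-squeeze : ∀ {s t u} → s ≤lex t → t ≤lex u → length s ≡ length t →
  ∀ i → AgreeBelow i (extendZeros s) (extendZeros u) → AgreeBelow i (extendZeros t) (extendZeros u)
≤lex-squeeze {t = []}    []≤ _ _  i h = h
≤lex-squeeze {t = _ ∷ _} []≤ _ ()
≤lex-squeeze {u = []}    (here _)  () _
≤lex-squeeze {u = []}    (there _) () _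
≤lex-squeeze {_ ∷ _} {_ ∷ _} {_ ∷ _} p q _ zero    _ _ ()
≤lex-squeeze {_ ∷ _} {_ ∷ _} {_ ∷ _} p q |s|≡|t| (suc i) h with ≤lex-∷-sandwich p q (h 0 z<s)
... | y≡z , p′ , q′ = λ where
  zero    _         → y≡z
  (suc m) (s≤s m<i) → ≤lex-squeeze p′ q′ (suc-injective |s|≡|t|) i (λ j j<i → h (suc j) (s≤s j<i)) m m<i

IsBranch-∷ʳ⁻ : ∀ {f k τ c} → IsBinaryTree f → IsBranch f (suc k) (τ ∷ʳ c) → IsBranch f k τ
IsBranch-∷ʳ⁻ {τ = τ} {c} (prefix-closed , _) (|τc|≡1+k , τc-binary , τc∈f) =
  suc-injective (trans (sym (length-∷ʳ τ c)) |τc|≡1+k) , Binary-++⁻ˡ τ τc-binary , prefix-closed τ [ c ] τc∈f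

initSeg-IsBranch : ∀ {f b} → IsPath f b → ∀ k → IsBranch f k (initSeg b k)
initSeg-IsBranch {b = b} (b≤1 , b∈f) k =
  trans (length-map b (upTo k)) (length-upTo k) , Binary-map b≤1 (upTo k) , b∈f k

leftmost-∷ʳ0-≤lex : ∀ {f k σ σ′} → IsBinaryTree f → IsLeftmostBranch f k σ → IsBranch f (suc k) σ′ →
  (σ ∷ʳ 0) ≤lex σ′
leftmost-∷ʳ0-≤lex {σ′ = σ′} tree ((|σ|≡k , _) , leftmost) branch′ with initLast σ′
leftmost-∷ʳ0-≤lex tree _ (() , _) | []
... | τ ∷ʳ′ c with IsBranch-∷ʳ⁻ tree branch′
...   | τ-branch@(|τ|≡k , _) = ≤lex-∷ʳ (leftmost τ τ-branch) (trans |σ|≡k (sym |τ|≡k)) z≤n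

leftmost-suc-agreesBelow : ∀ {f k σ σ′ b} → IsBinaryTree f →
  IsLeftmostBranch f k σ → IsLeftmostBranch f (suc k) σ′ → IsPath f b →
  ∀ i → AgreeBelow i (extendZeros σ) b → AgreeBelow i (extendZeros σ′) b
leftmost-suc-agreesBelow {f} {k} {σ} {σ′} {b} tree leftmostσ@((|σ|≡k , _) , _)
  (branchσ′@(|σ′|≡1+k , _) , leftmostσ′) path i σ≐b m m<i with m <? suc k
... | yes m<1+k = begin
  extendZeros σ′ m                  ≡⟨ ≤lex-squeeze σ0≤σ′ σ′≤b̄ |σ0|≡|σ′| (suc m) σ0≐b̄ m ℕ.≤-refl ⟩
  extendZeros (initSeg b (suc k)) m ≡⟨ extendZeros-initSeg b m<1+k ⟩
  b m                               ∎
  where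
  open ≡-Reasoning
  σ0≤σ′ : (σ ∷ʳ 0) ≤lex σ′
  σ0≤σ′ = leftmost-∷ʳ0-≤lex tree leftmostσ branchσ′
  σ′≤b̄ : σ′ ≤lex initSeg b (suc k)
  σ′≤b̄ = leftmostσ′ _ (initSeg-IsBranch {f} path (suc k))
  |σ0|≡|σ′| : length (σ ∷ʳ 0) ≡ length σ′
  |σ0|≡|σ′| = trans (length-∷ʳ σ 0) (trans (cong suc |σ|≡k) (sym |σ′|≡1+k))
  σ0≐b̄ : AgreeBelow (suc m) (extendZeros (σ ∷ʳ 0)) (extendZeros (initSeg b (suc k)))
  σ0≐b̄ j (s≤s j≤m) = begin
    extendZeros (σ ∷ʳ 0) j            ≡⟨ extendZeros-∷ʳ0 σ j ⟩
    extendZeros σ j                   ≡⟨ σ≐b j (ℕ.≤-<-trans j≤m m<i) ⟩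
    b j                               ≡⟨ extendZeros-initSeg b (ℕ.≤-<-trans j≤m m<1+k) ⟨
    extendZeros (initSeg b (suc k)) j ∎
... | no m≮1+k = begin
  extendZeros σ′ m ≡⟨ extendZeros-≥length σ′ (subst (ℕ._≤ m) (sym |σ′|≡1+k) 1+k≤m) ⟩
  0                ≡⟨ extendZeros-≥length σ (subst (ℕ._≤ m) (sym |σ|≡k) (<⇒≤ 1+k≤m)) ⟨
  extendZeros σ m  ≡⟨ σ≐b m m<i ⟩
  b m              ∎
  where
  open ≡-Reasoning
  1+k≤m : suc k ℕ.≤ m
  1+k≤m = ≮⇒≥ m≮1+k

-- Infinitude of f is only needed for the branches σ k to exist, which is assumed here.
proposition2p9 : (f : List ℕ → ℕ) → IsBinaryTree f → IsInfinite f →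
    (σ : ℕ → List ℕ) → (∀ k → IsLeftmostBranch f k (σ k)) →
    ∀ (b : ℕ → ℕ) → IsPath f b → ∀ (k : ℕ) (r s : ℚ) →
    BaireDist (extendZeros (σ (suc k))) b r →
    BaireDist (extendZeros (σ k)) b s →
    r ≤ s
proposition2p9 f tree _ σ leftmost b path k r s =
  BaireDist-≤ (leftmost-suc-agreesBelow tree (leftmost k) (leftmost (suc k)) path)
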